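{- Define the polynomial $\phi(\alpha_1,\alpha_2,\alpha_3,\beta_1,\beta_2,\beta_3)$ by $$\begin{aligned} \phi ={}& -(\alpha_2\beta_3+\alpha_3\beta_2)\alpha_1^8\alpha_2^2\alpha_3^2\beta_2^4\beta_3^4\\ &-(\alpha_2^4\beta_3^4-\alpha_2^3\alpha_3\beta_2\beta_3^3+\alpha_2^2\alpha_3^2\beta_2^2\beta_3^2-\alpha_2\alpha_3^3\beta_2^3\beta_3+\alpha_3^4\beta_2^4)(\alpha_2\beta_3+\alpha_3\beta_2)^2\alpha_1^7\beta_1\beta_2\beta_3\\ &-(\alpha_2\beta_3+\alpha_3\beta_2)(\alpha_2^4\beta_3^4+\alpha_2^2\alpha_3^2\beta_2^2\beta_3^2+\alpha_3^4\beta_2^4)\alpha_1^6\alpha_2\alpha_3\beta_1^2\beta_2\beta_3\\ &-2\alpha_1^5\alpha_2^4\alpha_3^4\beta_1^3\beta_2^3\beta_3^3\\ &-(\alpha_2\beta_3+\alpha_3\beta_2)(\alpha_2^4\beta_3^4-2\alpha_2^3\alpha_3\beta_2\beta_3^3+\alpha_2^2\alpha_3^2\beta_2^2\beta_3^2-2\alpha_2\alpha_3^3\beta_2^3\beta_3+\alpha_3^4\beta_2^4)\alpha_1^4\alpha_2^2\alpha_3^2\beta_1^4\\ &+2(\alpha_2^2\beta_3^2+\alpha_2\alpha_3\beta_2\beta_3+\alpha_3^2\beta_2^2)\alpha_1^3\alpha_2^4\alpha_3^4\beta_1^5\beta_2\beta_3\\ &+(\alpha_2\beta_3+\alpha_3\beta_2)(\alpha_2^2\beta_3^2+\alpha_3^2\beta_2^2)\alpha_1^2\alpha_2^4\alpha_3^4\beta_1^6\\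 &+(\alpha_2^2\beta_3^2+\alpha_3^2\beta_2^2)\alpha_1\alpha_2^5\alpha_3^5\beta_1^7 . \end{aligned}$$ Let $p,q,r,u,v,w$ be arbitrary integers, and let $$A=\begin{bmatrix} \phi(p,q,r,u,v,w) & \phi(q,r,p,v,w,u) & \phi(r,p,q,w,u,v)\\ p & q & r\\ u & v & w \end{bmatrix}.$$ Then $\det A=k$ and $\det(A^{(3)})=k^3$, where $$\begin{aligned} k={}& pqr(pv-qu)(pw-ru)(qw-rv)(p^2v^2+pquv+q^2u^2)\\ &\times(p^2w^2+pruw+r^2u^2)(q^2w^2+qrvw+r^2v^2)(pqw+prv+qru). \end{aligned}$$
   Context: For a matrix $A=(a_{ij})$, $A^{(3)}$ denotes the matrix $(a_{ij}^3)$ obtained by replacing each entry of $A$ by its cube. -}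

module Defs where

open import Data.Integer using (ℤ; +_; _+_; _-_; _*_; -_)
open import Data.Nat using (ℕ)
open import Data.Fin using (Fin; zero; suc)
open import Data.Integer using () renaming (_^_ to _^ᶻ_) public

infixr 8 _^_
_^_ : ℤ → ℕ → ℤ
x ^ n = x ^ᶻ n

φ : ℤ → ℤ → ℤ → ℤ → ℤ → ℤ → ℤ
φ a1 a2 a3 b1 b2 b3 =
    (- ((a2 * b3 + a3 * b2) * a1 ^ 8 * a2 ^ 2 * a3 ^ 2 * b2 ^ 4 * b3 ^ 4))
  - ((a2 ^ 4 * b3 ^ 4 - a2 ^ 3 * a3 * b2 * b3 ^ 3 + a2 ^ 2 * a3 ^ 2 * b2 ^ 2 * b3 ^ 2
       - a2 * a3 ^ 3 * b2 ^ 3 * b3 + a3 ^ 4 * b2 ^ 4)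
      * (a2 * b3 + a3 * b2) ^ 2 * a1 ^ 7 * b1 * b2 * b3)
  - ((a2 * b3 + a3 * b2) * (a2 ^ 4 * b3 ^ 4 + a2 ^ 2 * a3 ^ 2 * b2 ^ 2 * b3 ^ 2 + a3 ^ 4 * b2 ^ 4)
      * a1 ^ 6 * a2 * a3 * b1 ^ 2 * b2 * b3)
  - (+ 2 * a1 ^ 5 * a2 ^ 4 * a3 ^ 4 * b1 ^ 3 * b2 ^ 3 * b3 ^ 3)
  - ((a2 * b3 + a3 * b2)
      * (a2 ^ 4 * b3 ^ 4 - + 2 * a2 ^ 3 * a3 * b2 * b3 ^ 3 + a2 ^ 2 * a3 ^ 2 * b2 ^ 2 * b3 ^ 2
         - + 2 * a2 * a3 ^ 3 * b2 ^ 3 * b3 + a3 ^ 4 * b2 ^ 4)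
      * a1 ^ 4 * a2 ^ 2 * a3 ^ 2 * b1 ^ 4)
  + (+ 2 * (a2 ^ 2 * b3 ^ 2 + a2 * a3 * b2 * b3 + a3 ^ 2 * b2 ^ 2)
      * a1 ^ 3 * a2 ^ 4 * a3 ^ 4 * b1 ^ 5 * b2 * b3)
  + ((a2 * b3 + a3 * b2) * (a2 ^ 2 * b3 ^ 2 + a3 ^ 2 * b2 ^ 2)
      * a1 ^ 2 * a2 ^ 4 * a3 ^ 4 * b1 ^ 6)
  + ((a2 ^ 2 * b3 ^ 2 + a3 ^ 2 * b2 ^ 2) * a1 * a2 ^ 5 * a3 ^ 5 * b1 ^ 7)

Mat3 : Set
Mat3 = Fin 3 → Fin 3 → ℤ

i0 i1 i2 : Fin 3
i0 = zero
i1 = suc zero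
i2 = suc (suc zero)

det3 : Mat3 → ℤ
det3 M =
    M i0 i0 * M i1 i1 * M i2 i2 + M i0 i1 * M i1 i2 * M i2 i0 + M i0 i2 * M i1 i0 * M i2 i1
  - M i0 i2 * M i1 i1 * M i2 i0 - M i0 i0 * M i1 i2 * M i2 i1 - M i0 i1 * M i1 i0 * M i2 i2

cubeEntries : Mat3 → Mat3
cubeEntries M i j = M i j ^ 3

matA : ℤ → ℤ → ℤ → ℤ → ℤ → ℤ → Mat3
matA p q r u v w zero zero = φ p q r u v w
matA p q r u v w zero (suc zero) = φ q r p v w u
matA p q r u v w zero (suc (suc zero)) = φ r p q w u v
matA p q r u v w (suc zero) zero = p
matA p q r u v w (suc zero) (suc zero) = q
matA p q r u v w (suc zero) (suc (suc zero)) = r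
matA p q r u v w (suc (suc zero)) zero = u
matA p q r u v w (suc (suc zero)) (suc zero) = v
matA p q r u v w (suc (suc zero)) (suc (suc zero)) = w

kVal : ℤ → ℤ → ℤ → ℤ → ℤ → ℤ → ℤ
kVal p q r u v w =
  p * q * r * (p * v - q * u) * (p * w - r * u) * (q * w - r * v)
  * (p ^ 2 * v ^ 2 + p * q * u * v + q ^ 2 * u ^ 2)
  * (p ^ 2 * w ^ 2 + p * r * u * w + r ^ 2 * u ^ 2)
  * (q ^ 2 * w ^ 2 + q * r * v * w + r ^ 2 * v ^ 2)
  * (p * q * w + p * r * v + q * r * u)

-- Both equations are identities in ℤ[p,q,r,u,v,w] (of degrees 24 and 72), so they are decided by
-- computation: each side is written as a polynomial expression, reduced to a canonical sparse normal
-- form, and the two normal forms are compared by refl; soundness of the normaliser transfers the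
-- equation to every integer instance.
{-# OPTIONS --safe #-}
module Submission where

open import Defs
open import Data.Integer using (ℤ; +_; 0ℤ; 1ℤ; _+_; _-_; _*_; -_)
open import Data.Integer.Properties as ℤ
  using (*-identityˡ; *-identityʳ; *-zeroʳ; *-distribʳ-+; *-distribˡ-+; +-identityˡ; +-identityʳ;
         +-assoc; neg-distrib-+; neg-distribˡ-*; ^-distribˡ-+-*;
         *-commutativeSemigroup; +-commutativeSemigroup)
open import Data.Integer.Solver using (module +-*-Solver)
open +-*-Solver using (Polynomial; op; [+]; [*]; con; var; _:+_; _:*_; _:-_; _:^_; :-_; ⟦_⟧)
open import Algebra.Properties.CommutativeSemigroup *-commutativeSemigroup
  using () renaming (interchange to *-interchange)
open import Algebra.Properties.CommutativeSemigroup +-commutativeSemigroup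
  using (x∙yz≈y∙xz) renaming (interchange to +-interchange)
open import Data.Bool using (Bool; true; false; if_then_else_; _∧_; _∨_)
open import Data.Fin using (Fin; zero; suc; #_)
open import Data.List using (List; []; _∷_)
open import Data.Nat as ℕ using (ℕ; zero; suc; _<ᵇ_; _≡ᵇ_)
open import Data.Product using (_×_; _,_)
open import Data.Vec using (Vec; []; _∷_; replicate; zipWith; lookup)
open import Data.Vec.Properties using (≡-dec)
open import Relation.Binary.Definitions using (DecidableEquality)
open import Relation.Nullary using (does; yes; no)
open import Relation.Binary.PropositionalEquality
  using (_≡_; refl; sym; trans; cong; cong₂; module ≡-Reasoning)
open ≡-Reasoning

private
  variable
    n : ℕ

Monomial : ℕ → Set
Monomial n = Vec ℕ n

evalMonomial : Monomial n → Vec ℤ n → ℤ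
evalMonomial []       []      = 1ℤ
evalMonomial (e ∷ es) (x ∷ ρ) = x ^ e * evalMonomial es ρ

unitMonomial : Monomial n
unitMonomial = replicate _ 0

varMonomial : Fin n → Monomial n
varMonomial zero    = 1 ∷ unitMonomial
varMonomial (suc i) = 0 ∷ varMonomial i

_·ᵐ_ : Monomial n → Monomial n → Monomial n
_·ᵐ_ = zipWith ℕ._+_

_≟ᵐ_ : DecidableEquality (Monomial n)
_≟ᵐ_ = ≡-dec ℕ._≟_

_<ᵐ_ : Monomial n → Monomial n → Bool
[]       <ᵐ []       = false
(a ∷ as) <ᵐ (b ∷ bs) = (a <ᵇ b) ∨ ((a ≡ᵇ b) ∧ (as <ᵐ bs))

evalMonomial-unit : (ρ : Vec ℤ n) → evalMonomial unitMonomial ρ ≡ 1ℤ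
evalMonomial-unit []      = refl
evalMonomial-unit (x ∷ ρ) = cong (1ℤ *_) (evalMonomial-unit ρ)

evalMonomial-var : ∀ i (ρ : Vec ℤ n) → evalMonomial (varMonomial i) ρ ≡ lookup ρ i
evalMonomial-var zero    (x ∷ ρ) = begin
  x * 1ℤ * evalMonomial unitMonomial ρ ≡⟨ cong (x * 1ℤ *_) (evalMonomial-unit ρ) ⟩
  x * 1ℤ * 1ℤ                          ≡⟨ *-identityʳ (x * 1ℤ) ⟩
  x * 1ℤ                               ≡⟨ *-identityʳ x ⟩
  x                                    ∎
evalMonomial-var (suc i) (x ∷ ρ) = trans (*-identityˡ _) (evalMonomial-var i ρ)

evalMonomial-· : ∀ (e f : Monomial n) ρ →
                 evalMonomial (e ·ᵐ f) ρ ≡ evalMonomial e ρ * evalMonomial f ρ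
evalMonomial-· []       []       []      = refl
evalMonomial-· (a ∷ es) (b ∷ fs) (x ∷ ρ) = begin
  x ^ (a ℕ.+ b) * evalMonomial (es ·ᵐ fs) ρ
    ≡⟨ cong₂ _*_ (^-distribˡ-+-* x a b) (evalMonomial-· es fs ρ) ⟩
  (x ^ a * x ^ b) * (evalMonomial es ρ * evalMonomial fs ρ)
    ≡⟨ *-interchange (x ^ a) (x ^ b) (evalMonomial es ρ) (evalMonomial fs ρ) ⟩
  (x ^ a * evalMonomial es ρ) * (x ^ b * evalMonomial fs ρ) ∎

-- A normal form is kept strictly sorted by _<ᵐ_ and free of zero coefficients, so that equal
-- polynomials get identical normal forms.  _⊙_ needs no zero test and no re-sorting: ℤ has no zero
-- divisors and the lexicographic order is compatible with multiplication of monomials.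
NormalForm : ℕ → Set
NormalForm n = List (ℤ × Monomial n)

⟦_⟧ₙ : NormalForm n → Vec ℤ n → ℤ
⟦ []           ⟧ₙ ρ = 0ℤ
⟦ (c , e) ∷ xs ⟧ₙ ρ = c * evalMonomial e ρ + ⟦ xs ⟧ₙ ρ

infixr 5 _∷≠0_
_∷≠0_ : ℤ × Monomial n → NormalForm n → NormalForm n
(c , e) ∷≠0 xs = if does (c ℤ.≟ 0ℤ) then xs else (c , e) ∷ xs

⟦∷≠0⟧ : ∀ (t : ℤ × Monomial n) xs ρ → ⟦ t ∷≠0 xs ⟧ₙ ρ ≡ ⟦ t ∷ xs ⟧ₙ ρ
⟦∷≠0⟧ (c , e) xs ρ with c ℤ.≟ 0ℤ
... | yes refl = sym (+-identityˡ (⟦ xs ⟧ₙ ρ))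
... | no _     = refl

constant : ℤ → NormalForm n
constant c = (c , unitMonomial) ∷≠0 []

⟦constant⟧ : ∀ c (ρ : Vec ℤ n) → ⟦ constant c ⟧ₙ ρ ≡ c
⟦constant⟧ c ρ = begin
  ⟦ constant c ⟧ₙ ρ                     ≡⟨ ⟦∷≠0⟧ (c , unitMonomial) [] ρ ⟩
  c * evalMonomial unitMonomial ρ + 0ℤ  ≡⟨ +-identityʳ _ ⟩
  c * evalMonomial unitMonomial ρ       ≡⟨ cong (c *_) (evalMonomial-unit ρ) ⟩
  c * 1ℤ                                ≡⟨ *-identityʳ c ⟩
  c                                     ∎

infixl 6 _⊕_
_⊕_ : NormalForm n → NormalForm n → NormalForm n
[]             ⊕ ys             = ys
(x ∷ xs)       ⊕ []             = x ∷ xs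
((c , e) ∷ xs) ⊕ ((d , f) ∷ ys) =
  if does (e ≟ᵐ f) then (c + d , e) ∷≠0 (xs ⊕ ys)
  else if e <ᵐ f then (c , e) ∷ (xs ⊕ ((d , f) ∷ ys))
  else (d , f) ∷ (((c , e) ∷ xs) ⊕ ys)

-- The cons/cons case of ⟦⊕⟧ is proved separately from its induction hypotheses, since doing the
-- case analysis inside ⟦⊕⟧ hides the lexicographic descent from the termination checker.
⊕-Homomorphic : NormalForm n → NormalForm n → Vec ℤ n → Set
⊕-Homomorphic xs ys ρ = ⟦ xs ⊕ ys ⟧ₙ ρ ≡ ⟦ xs ⟧ₙ ρ + ⟦ ys ⟧ₙ ρ

⟦⊕⟧-∷ : ∀ c e (xs : NormalForm n) d f ys ρ →
         ⊕-Homomorphic xs ys ρ → ⊕-Homomorphic xs ((d , f) ∷ ys) ρ →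
         ⊕-Homomorphic ((c , e) ∷ xs) ys ρ → ⊕-Homomorphic ((c , e) ∷ xs) ((d , f) ∷ ys) ρ
⟦⊕⟧-∷ c e xs d f ys ρ ih ihˡ ihʳ with e ≟ᵐ f
... | yes refl = begin
  ⟦ (c + d , e) ∷≠0 (xs ⊕ ys) ⟧ₙ ρ            ≡⟨ ⟦∷≠0⟧ (c + d , e) (xs ⊕ ys) ρ ⟩
  (c + d) * m + ⟦ xs ⊕ ys ⟧ₙ ρ                ≡⟨ cong₂ _+_ (*-distribʳ-+ m c d) ih ⟩
  (c * m + d * m) + (⟦ xs ⟧ₙ ρ + ⟦ ys ⟧ₙ ρ)   ≡⟨ +-interchange (c * m) (d * m) (⟦ xs ⟧ₙ ρ) (⟦ ys ⟧ₙ ρ) ⟩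
  (c * m + ⟦ xs ⟧ₙ ρ) + (d * m + ⟦ ys ⟧ₙ ρ)   ∎
  where m = evalMonomial e ρ
... | no _ with e <ᵐ f
...   | true  = begin
  c * evalMonomial e ρ + ⟦ xs ⊕ ((d , f) ∷ ys) ⟧ₙ ρ
    ≡⟨ cong (_+_ (c * evalMonomial e ρ)) ihˡ ⟩
  c * evalMonomial e ρ + (⟦ xs ⟧ₙ ρ + ⟦ (d , f) ∷ ys ⟧ₙ ρ)
    ≡⟨ sym (+-assoc (c * evalMonomial e ρ) (⟦ xs ⟧ₙ ρ) (⟦ (d , f) ∷ ys ⟧ₙ ρ)) ⟩
  c * evalMonomial e ρ + ⟦ xs ⟧ₙ ρ + ⟦ (d , f) ∷ ys ⟧ₙ ρ ∎
...   | false = begin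
  d * evalMonomial f ρ + ⟦ ((c , e) ∷ xs) ⊕ ys ⟧ₙ ρ
    ≡⟨ cong (_+_ (d * evalMonomial f ρ)) ihʳ ⟩
  d * evalMonomial f ρ + (⟦ (c , e) ∷ xs ⟧ₙ ρ + ⟦ ys ⟧ₙ ρ)
    ≡⟨ x∙yz≈y∙xz (d * evalMonomial f ρ) (⟦ (c , e) ∷ xs ⟧ₙ ρ) (⟦ ys ⟧ₙ ρ) ⟩
  ⟦ (c , e) ∷ xs ⟧ₙ ρ + (d * evalMonomial f ρ + ⟦ ys ⟧ₙ ρ) ∎

⟦⊕⟧ : ∀ (xs ys : NormalForm n) ρ → ⊕-Homomorphic xs ys ρ
⟦⊕⟧ []             ys             ρ = sym (+-identityˡ (⟦ ys ⟧ₙ ρ))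
⟦⊕⟧ (x ∷ xs)       []             ρ = sym (+-identityʳ (⟦ x ∷ xs ⟧ₙ ρ))
⟦⊕⟧ ((c , e) ∷ xs) ((d , f) ∷ ys) ρ =
  ⟦⊕⟧-∷ c e xs d f ys ρ (⟦⊕⟧ xs ys ρ) (⟦⊕⟧ xs ((d , f) ∷ ys) ρ) (⟦⊕⟧ ((c , e) ∷ xs) ys ρ)

infixr 7 _⊙_
_⊙_ : ℤ × Monomial n → NormalForm n → NormalForm n
t       ⊙ []             = []
(c , e) ⊙ ((d , f) ∷ ys) = (c * d , e ·ᵐ f) ∷ (c , e) ⊙ ys

⟦⊙⟧ : ∀ c e (ys : NormalForm n) ρ → ⟦ (c , e) ⊙ ys ⟧ₙ ρ ≡ c * evalMonomial e ρ * ⟦ ys ⟧ₙ ρ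
⟦⊙⟧ c e []             ρ = sym (*-zeroʳ (c * evalMonomial e ρ))
⟦⊙⟧ c e ((d , f) ∷ ys) ρ = begin
  c * d * evalMonomial (e ·ᵐ f) ρ + ⟦ (c , e) ⊙ ys ⟧ₙ ρ
    ≡⟨ cong₂ _+_ (cong (c * d *_) (evalMonomial-· e f ρ)) (⟦⊙⟧ c e ys ρ) ⟩
  c * d * (evalMonomial e ρ * evalMonomial f ρ) + c * evalMonomial e ρ * ⟦ ys ⟧ₙ ρ
    ≡⟨ cong (_+ c * evalMonomial e ρ * ⟦ ys ⟧ₙ ρ) (*-interchange c d (evalMonomial e ρ) (evalMonomial f ρ)) ⟩
  c * evalMonomial e ρ * (d * evalMonomial f ρ) + c * evalMonomial e ρ * ⟦ ys ⟧ₙ ρ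
    ≡⟨ sym (*-distribˡ-+ (c * evalMonomial e ρ) (d * evalMonomial f ρ) (⟦ ys ⟧ₙ ρ)) ⟩
  c * evalMonomial e ρ * (d * evalMonomial f ρ + ⟦ ys ⟧ₙ ρ) ∎

infixl 7 _⊗_
_⊗_ : NormalForm n → NormalForm n → NormalForm n
[]       ⊗ ys = []
(x ∷ xs) ⊗ ys = x ⊙ ys ⊕ xs ⊗ ys

⟦⊗⟧ : ∀ (xs ys : NormalForm n) ρ → ⟦ xs ⊗ ys ⟧ₙ ρ ≡ ⟦ xs ⟧ₙ ρ * ⟦ ys ⟧ₙ ρ
⟦⊗⟧ []             ys ρ = refl
⟦⊗⟧ ((c , e) ∷ xs) ys ρ = begin
  ⟦ (c , e) ⊙ ys ⊕ xs ⊗ ys ⟧ₙ ρ                       ≡⟨ ⟦⊕⟧ ((c , e) ⊙ ys) (xs ⊗ ys) ρ ⟩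
  ⟦ (c , e) ⊙ ys ⟧ₙ ρ + ⟦ xs ⊗ ys ⟧ₙ ρ                 ≡⟨ cong₂ _+_ (⟦⊙⟧ c e ys ρ) (⟦⊗⟧ xs ys ρ) ⟩
  c * evalMonomial e ρ * ⟦ ys ⟧ₙ ρ + ⟦ xs ⟧ₙ ρ * ⟦ ys ⟧ₙ ρ
    ≡⟨ sym (*-distribʳ-+ (⟦ ys ⟧ₙ ρ) (c * evalMonomial e ρ) (⟦ xs ⟧ₙ ρ)) ⟩
  (c * evalMonomial e ρ + ⟦ xs ⟧ₙ ρ) * ⟦ ys ⟧ₙ ρ       ∎

⊝_ : NormalForm n → NormalForm n
⊝ []             = []
⊝ ((c , e) ∷ xs) = (- c , e) ∷ ⊝ xs

⟦⊝⟧ : ∀ (xs : NormalForm n) ρ → ⟦ ⊝ xs ⟧ₙ ρ ≡ - ⟦ xs ⟧ₙ ρ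
⟦⊝⟧ []             ρ = refl
⟦⊝⟧ ((c , e) ∷ xs) ρ = begin
  - c * evalMonomial e ρ + ⟦ ⊝ xs ⟧ₙ ρ      ≡⟨ cong₂ _+_ (sym (neg-distribˡ-* c (evalMonomial e ρ))) (⟦⊝⟧ xs ρ) ⟩
  - (c * evalMonomial e ρ) + - ⟦ xs ⟧ₙ ρ    ≡⟨ sym (neg-distrib-+ (c * evalMonomial e ρ) (⟦ xs ⟧ₙ ρ)) ⟩
  - (c * evalMonomial e ρ + ⟦ xs ⟧ₙ ρ)      ∎

infixr 8 _^ₙ_
_^ₙ_ : NormalForm n → ℕ → NormalForm n
xs ^ₙ zero  = constant 1ℤ
xs ^ₙ suc k = xs ⊗ xs ^ₙ k

normalise : Polynomial n → NormalForm n
normalise (op [+] p q) = normalise p ⊕ normalise q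
normalise (op [*] p q) = normalise p ⊗ normalise q
normalise (con c)      = constant c
normalise (var i)      = (1ℤ , varMonomial i) ∷ []
normalise (p :^ k)     = normalise p ^ₙ k
normalise (:- p)       = ⊝ normalise p

normalise-sound : ∀ (p : Polynomial n) ρ → ⟦ normalise p ⟧ₙ ρ ≡ ⟦ p ⟧ ρ
normalise-sound (op [+] p q) ρ =
  trans (⟦⊕⟧ (normalise p) (normalise q) ρ) (cong₂ _+_ (normalise-sound p ρ) (normalise-sound q ρ))
normalise-sound (op [*] p q) ρ =
  trans (⟦⊗⟧ (normalise p) (normalise q) ρ) (cong₂ _*_ (normalise-sound p ρ) (normalise-sound q ρ))
normalise-sound (con c)      ρ = ⟦constant⟧ c ρ
normalise-sound (var i)      ρ = begin
  1ℤ * evalMonomial (varMonomial i) ρ + 0ℤ ≡⟨ +-identityʳ _ ⟩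
  1ℤ * evalMonomial (varMonomial i) ρ      ≡⟨ *-identityˡ _ ⟩
  evalMonomial (varMonomial i) ρ           ≡⟨ evalMonomial-var i ρ ⟩
  lookup ρ i                               ∎
normalise-sound (p :^ k)     ρ = power-sound k
  where
  power-sound : ∀ k → ⟦ normalise (p :^ k) ⟧ₙ ρ ≡ ⟦ p :^ k ⟧ ρ
  power-sound zero    = ⟦constant⟧ 1ℤ ρ
  power-sound (suc k) =
    trans (⟦⊗⟧ (normalise p) (normalise (p :^ k)) ρ) (cong₂ _*_ (normalise-sound p ρ) (power-sound k))
normalise-sound (:- p)       ρ = trans (⟦⊝⟧ (normalise p) ρ) (cong -_ (normalise-sound p ρ))

≡-by-normalisation : ∀ (p q : Polynomial n) → normalise p ≡ normalise q →
                     ∀ ρ → ⟦ p ⟧ ρ ≡ ⟦ q ⟧ ρ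
≡-by-normalisation p q p≡q ρ = begin
  ⟦ p ⟧ ρ             ≡⟨ sym (normalise-sound p ρ) ⟩
  ⟦ normalise p ⟧ₙ ρ  ≡⟨ cong (λ xs → ⟦ xs ⟧ₙ ρ) p≡q ⟩
  ⟦ normalise q ⟧ₙ ρ  ≡⟨ normalise-sound q ρ ⟩
  ⟦ q ⟧ ρ             ∎

φ′ : (a1 a2 a3 b1 b2 b3 : Polynomial n) → Polynomial n
φ′ a1 a2 a3 b1 b2 b3 =
    (:- ((a2 :* b3 :+ a3 :* b2) :* a1 :^ 8 :* a2 :^ 2 :* a3 :^ 2 :* b2 :^ 4 :* b3 :^ 4))
  :- ((a2 :^ 4 :* b3 :^ 4 :- a2 :^ 3 :* a3 :* b2 :* b3 :^ 3 :+ a2 :^ 2 :* a3 :^ 2 :* b2 :^ 2 :* b3 :^ 2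
       :- a2 :* a3 :^ 3 :* b2 :^ 3 :* b3 :+ a3 :^ 4 :* b2 :^ 4)
      :* (a2 :* b3 :+ a3 :* b2) :^ 2 :* a1 :^ 7 :* b1 :* b2 :* b3)
  :- ((a2 :* b3 :+ a3 :* b2) :* (a2 :^ 4 :* b3 :^ 4 :+ a2 :^ 2 :* a3 :^ 2 :* b2 :^ 2 :* b3 :^ 2 :+ a3 :^ 4 :* b2 :^ 4)
      :* a1 :^ 6 :* a2 :* a3 :* b1 :^ 2 :* b2 :* b3)
  :- (con (+ 2) :* a1 :^ 5 :* a2 :^ 4 :* a3 :^ 4 :* b1 :^ 3 :* b2 :^ 3 :* b3 :^ 3)
  :- ((a2 :* b3 :+ a3 :* b2)
      :* (a2 :^ 4 :* b3 :^ 4 :- con (+ 2) :* a2 :^ 3 :* a3 :* b2 :* b3 :^ 3 :+ a2 :^ 2 :* a3 :^ 2 :* b2 :^ 2 :* b3 :^ 2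
         :- con (+ 2) :* a2 :* a3 :^ 3 :* b2 :^ 3 :* b3 :+ a3 :^ 4 :* b2 :^ 4)
      :* a1 :^ 4 :* a2 :^ 2 :* a3 :^ 2 :* b1 :^ 4)
  :+ (con (+ 2) :* (a2 :^ 2 :* b3 :^ 2 :+ a2 :* a3 :* b2 :* b3 :+ a3 :^ 2 :* b2 :^ 2)
      :* a1 :^ 3 :* a2 :^ 4 :* a3 :^ 4 :* b1 :^ 5 :* b2 :* b3)
  :+ ((a2 :* b3 :+ a3 :* b2) :* (a2 :^ 2 :* b3 :^ 2 :+ a3 :^ 2 :* b2 :^ 2)
      :* a1 :^ 2 :* a2 :^ 4 :* a3 :^ 4 :* b1 :^ 6)
  :+ ((a2 :^ 2 :* b3 :^ 2 :+ a3 :^ 2 :* b2 :^ 2) :* a1 :* a2 :^ 5 :* a3 :^ 5 :* b1 :^ 7)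

det3′ : (Fin 3 → Fin 3 → Polynomial n) → Polynomial n
det3′ M =
    M i0 i0 :* M i1 i1 :* M i2 i2 :+ M i0 i1 :* M i1 i2 :* M i2 i0 :+ M i0 i2 :* M i1 i0 :* M i2 i1
  :- M i0 i2 :* M i1 i1 :* M i2 i0 :- M i0 i0 :* M i1 i2 :* M i2 i1 :- M i0 i1 :* M i1 i0 :* M i2 i2

cubeEntries′ : (Fin 3 → Fin 3 → Polynomial n) → Fin 3 → Fin 3 → Polynomial n
cubeEntries′ M i j = M i j :^ 3

kVal′ : (p q r u v w : Polynomial n) → Polynomial n
kVal′ p q r u v w =
  p :* q :* r :* (p :* v :- q :* u) :* (p :* w :- r :* u) :* (q :* w :- r :* v)
  :* (p :^ 2 :* v :^ 2 :+ p :* q :* u :* v :+ q :^ 2 :* u :^ 2)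
  :* (p :^ 2 :* w :^ 2 :+ p :* r :* u :* w :+ r :^ 2 :* u :^ 2)
  :* (q :^ 2 :* w :^ 2 :+ q :* r :* v :* w :+ r :^ 2 :* v :^ 2)
  :* (p :* q :* w :+ p :* r :* v :+ q :* r :* u)

matA′ : (p q r u v w : Polynomial n) → Fin 3 → Fin 3 → Polynomial n
matA′ p q r u v w zero             zero             = φ′ p q r u v w
matA′ p q r u v w zero             (suc zero)       = φ′ q r p v w u
matA′ p q r u v w zero             (suc (suc zero)) = φ′ r p q w u v
matA′ p q r u v w (suc zero)       zero             = p
matA′ p q r u v w (suc zero)       (suc zero)       = q
matA′ p q r u v w (suc zero)       (suc (suc zero)) = r
matA′ p q r u v w (suc (suc zero)) zero             = u
matA′ p q r u v w (suc (suc zero)) (suc zero)       = v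
matA′ p q r u v w (suc (suc zero)) (suc (suc zero)) = w

p′ q′ r′ u′ v′ w′ : Polynomial 6
p′ = var (# 0)
q′ = var (# 1)
r′ = var (# 2)
u′ = var (# 3)
v′ = var (# 4)
w′ = var (# 5)

A′ : Fin 3 → Fin 3 → Polynomial 6
A′ = matA′ p′ q′ r′ u′ v′ w′

k′ : Polynomial 6
k′ = kVal′ p′ q′ r′ u′ v′ w′

det-A′-normalises-to-k′ : normalise (det3′ A′) ≡ normalise k′
det-A′-normalises-to-k′ = refl

det-A′³-normalises-to-k′³ :
  normalise (det3′ (cubeEntries′ A′)) ≡ normalise (k′ :^ 3)
det-A′³-normalises-to-k′³ = refl

⟦φ′⟧ : ∀ (a1 a2 a3 b1 b2 b3 : Polynomial n) ρ →
        ⟦ φ′ a1 a2 a3 b1 b2 b3 ⟧ ρ ≡ φ (⟦ a1 ⟧ ρ) (⟦ a2 ⟧ ρ) (⟦ a3 ⟧ ρ) (⟦ b1 ⟧ ρ) (⟦ b2 ⟧ ρ) (⟦ b3 ⟧ ρ)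
⟦φ′⟧ a1 a2 a3 b1 b2 b3 ρ = refl

⟦det3′⟧ : ∀ (M : Fin 3 → Fin 3 → Polynomial n) ρ → ⟦ det3′ M ⟧ ρ ≡ det3 (λ i j → ⟦ M i j ⟧ ρ)
⟦det3′⟧ M ρ = refl

⟦kVal′⟧ : ∀ (p q r u v w : Polynomial n) ρ →
          ⟦ kVal′ p q r u v w ⟧ ρ ≡ kVal (⟦ p ⟧ ρ) (⟦ q ⟧ ρ) (⟦ r ⟧ ρ) (⟦ u ⟧ ρ) (⟦ v ⟧ ρ) (⟦ w ⟧ ρ)
⟦kVal′⟧ p q r u v w ρ = refl

⟦matA′⟧ : ∀ (p q r u v w : Polynomial n) ρ i j →
          ⟦ matA′ p q r u v w i j ⟧ ρ ≡ matA (⟦ p ⟧ ρ) (⟦ q ⟧ ρ) (⟦ r ⟧ ρ) (⟦ u ⟧ ρ) (⟦ v ⟧ ρ) (⟦ w ⟧ ρ) i j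
⟦matA′⟧ p q r u v w ρ zero             zero             = ⟦φ′⟧ p q r u v w ρ
⟦matA′⟧ p q r u v w ρ zero             (suc zero)       = ⟦φ′⟧ q r p v w u ρ
⟦matA′⟧ p q r u v w ρ zero             (suc (suc zero)) = ⟦φ′⟧ r p q w u v ρ
⟦matA′⟧ p q r u v w ρ (suc zero)       zero             = refl
⟦matA′⟧ p q r u v w ρ (suc zero)       (suc zero)       = refl
⟦matA′⟧ p q r u v w ρ (suc zero)       (suc (suc zero)) = refl
⟦matA′⟧ p q r u v w ρ (suc (suc zero)) zero             = refl
⟦matA′⟧ p q r u v w ρ (suc (suc zero)) (suc zero)       = refl
⟦matA′⟧ p q r u v w ρ (suc (suc zero)) (suc (suc zero)) = refl

-- Used instead of refl: checking det3 (matA …) ≡ ⟦ det3′ A′ ⟧ ρ directly by conversion is correct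
-- but makes Agda unfold the integer operations far too deeply.
det3-cong : ∀ {M N : Mat3} → (∀ i j → M i j ≡ N i j) → det3 M ≡ det3 N
det3-cong {M} {N} M≗N =
  cong₂ _-_ (cong₂ _-_ (cong₂ _-_ (cong₂ _+_ (cong₂ _+_
    (term i0 i0 i1 i1 i2 i2) (term i0 i1 i1 i2 i2 i0)) (term i0 i2 i1 i0 i2 i1))
    (term i0 i2 i1 i1 i2 i0)) (term i0 i0 i1 i2 i2 i1)) (term i0 i1 i1 i0 i2 i2)
  where
  term : ∀ i j k l i′ j′ → M i j * M k l * M i′ j′ ≡ N i j * N k l * N i′ j′
  term i j k l i′ j′ = cong₂ _*_ (cong₂ _*_ (M≗N i j) (M≗N k l)) (M≗N i′ j′)

theorem3p1 : (p q r u v w : ℤ) →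
    (det3 (matA p q r u v w) ≡ kVal p q r u v w)
    × (det3 (cubeEntries (matA p q r u v w)) ≡ kVal p q r u v w ^ 3)
theorem3p1 p q r u v w = det-A , det-A³
  where
  ρ : Vec ℤ 6
  ρ = p ∷ q ∷ r ∷ u ∷ v ∷ w ∷ []

  A≗⟦A′⟧ : ∀ i j → matA p q r u v w i j ≡ ⟦ A′ i j ⟧ ρ
  A≗⟦A′⟧ i j = sym (⟦matA′⟧ p′ q′ r′ u′ v′ w′ ρ i j)

  det-A : det3 (matA p q r u v w) ≡ kVal p q r u v w
  det-A = begin
    det3 (matA p q r u v w)           ≡⟨ det3-cong A≗⟦A′⟧ ⟩
    det3 (λ i j → ⟦ A′ i j ⟧ ρ)       ≡⟨ sym (⟦det3′⟧ A′ ρ) ⟩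
    ⟦ det3′ A′ ⟧ ρ                    ≡⟨ ≡-by-normalisation (det3′ A′) k′ det-A′-normalises-to-k′ ρ ⟩
    ⟦ k′ ⟧ ρ                          ≡⟨ ⟦kVal′⟧ p′ q′ r′ u′ v′ w′ ρ ⟩
    kVal p q r u v w                  ∎

  det-A³ : det3 (cubeEntries (matA p q r u v w)) ≡ kVal p q r u v w ^ 3
  det-A³ = begin
    det3 (cubeEntries (matA p q r u v w))  ≡⟨ det3-cong (λ i j → cong (_^ 3) (A≗⟦A′⟧ i j)) ⟩
    det3 (λ i j → ⟦ A′ i j :^ 3 ⟧ ρ)       ≡⟨ sym (⟦det3′⟧ (cubeEntries′ A′) ρ) ⟩
    ⟦ det3′ (cubeEntries′ A′) ⟧ ρ          ≡⟨ ≡-by-normalisation (det3′ (cubeEntries′ A′)) (k′ :^ 3)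
                                                det-A′³-normalises-to-k′³ ρ ⟩
    ⟦ k′ :^ 3 ⟧ ρ                          ≡⟨ cong (_^ 3) (⟦kVal′⟧ p′ q′ r′ u′ v′ w′ ρ) ⟩
    kVal p q r u v w ^ 3                   ∎
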